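{- Let $p,q\ge 3$ be coprime integers. For an integer $r\ge 3$ coprime to $pq$, every integer $n$ has a unique representation $n=x_nqr+y_nrp+z_npq+\delta_npqr$ with integers $0\le x_n<p$, $0\le y_n<q$, $0\le z_n<r$, $\delta_n\in\mathbb Z$ (depending on $r$); define $f_r(n)=x_nq+y_np$. If $r,s\ge 3$ are integers coprime to $pq$ with $r\equiv s\pmod{pq}$, and $n_1\equiv n_2\pmod{pq}$, then $f_r(n_1)=f_s(n_2)$. -}

module Defs where

open import Data.Nat using (ℕ)
open import Data.Integer using (ℤ; +_; _+_; _*_; _≤_; _<_; 0ℤ)
open import Relation.Binary.PropositionalEquality using (_≡_)

record Rep (p q r : ℕ) (n : ℤ) : Set where
  constructor rep
  field
    x y z δ : ℤ
    0≤x : 0ℤ ≤ x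
    x<p : x < + p
    0≤y : 0ℤ ≤ y
    y<q : y < + q
    0≤z : 0ℤ ≤ z
    z<r : z < + r
    eq  : n ≡ x * + q * + r + y * + r * + p + z * + p * + q + δ * + p * + q * + r

f : ∀ {p q r n} → Rep p q r n → ℤ
f {p} {q} R = Rep.x R * + q + Rep.y R * + p

module Submission where

-- Reducing  n = x·q·r + y·r·p + z·p·q + δ·p·q·r  modulo p
-- leaves  n ≡ x·(q·r) (mod p),  and modulo q it leaves  n ≡ y·(p·r) (mod q).
-- Hence the digit x of a representation is determined modulo p by the residue
-- of n mod p together with the residue of r mod p, and likewise for y mod q.
-- Under the hypotheses, n₁ ≡ n₂ and r ≡ s modulo both p and q, so
--   x₁·(q·r) ≡ n₁ ≡ n₂ ≡ x₂·(q·s) ≡ x₂·(q·r)  (mod p);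
-- as q·r is coprime to p the factor cancels, and since 0 ≤ x₁, x₂ < p the
-- congruence x₁ ≡ x₂ (mod p) is an equality.  Symmetrically y₁ = y₂, so
-- f_r(n₁) = x₁q + y₁p = x₂q + y₂p = f_s(n₂).

open import Defs
open import Data.Nat using (ℕ; _≤_; _*_)
open import Data.Nat.Coprimality using (Coprime)
open import Data.Integer using (ℤ; +_; _-_)
open import Data.Integer.Divisibility using (_∣_)
open import Relation.Binary.PropositionalEquality using (_≡_)

import Data.Nat as ℕ
import Data.Nat.Properties as ℕ
import Data.Nat.Divisibility as ℕ
import Data.Nat.Coprimality as ℕ
import Data.Integer as ℤ
import Data.Integer.Properties as ℤ
import Data.Integer.Coprimality as ℤ
import Data.Integer.Divisibility.Signed as Signed
open import Data.Integer.Tactic.RingSolver using (solve-∀)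
open import Data.Product using (_×_; _,_; proj₁; proj₂)
open import Relation.Binary.PropositionalEquality using (refl; sym; trans; cong; cong₂; subst)
open import Relation.Nullary using (contradiction)

-- Congruence of integers modulo a natural number: m divides a - b.  It is a
-- record rather than an abbreviation so that a, b and m stay inferable.
infix 4 _≡_[mod_]
record _≡_[mod_] (a b : ℤ) (m : ℕ) : Set where
  constructor congruent
  field divides : + m Signed.∣ a - b

private
  sub-anti : ∀ a b → b - a ≡ ℤ.- (a - b)
  sub-anti = solve-∀

  sub-chain : ∀ a b c → a - c ≡ (a - b) ℤ.+ (b - c)
  sub-chain = solve-∀

  sub-scale : ∀ c a b → c ℤ.* a - c ℤ.* b ≡ c ℤ.* (a - b)
  sub-scale = solve-∀

  sub-factor : ∀ a b u → a ℤ.* u - b ℤ.* u ≡ u ℤ.* (a - b)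
  sub-factor = solve-∀

≡mod-sym : ∀ {m a b} → a ≡ b [mod m ] → b ≡ a [mod m ]
≡mod-sym {a = a} {b} (congruent m∣a-b) =
  congruent (subst (_ Signed.∣_) (sym (sub-anti a b)) (Signed.∣m⇒∣-m m∣a-b))

≡mod-trans : ∀ {m a b c} → a ≡ b [mod m ] → b ≡ c [mod m ] → a ≡ c [mod m ]
≡mod-trans {a = a} {b} {c} (congruent m∣a-b) (congruent m∣b-c) =
  congruent (subst (_ Signed.∣_) (sym (sub-chain a b c)) (Signed.∣m∣n⇒∣m+n m∣a-b m∣b-c))

≡mod-*ˡ : ∀ {m a b} c → a ≡ b [mod m ] → c ℤ.* a ≡ c ℤ.* b [mod m ]
≡mod-*ˡ {a = a} {b} c (congruent m∣a-b) =
  congruent (subst (_ Signed.∣_) (sym (sub-scale c a b)) (Signed.∣n⇒∣m*n c m∣a-b))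

-- A congruence modulo m·k holds modulo each factor; the hypothesis is stated
-- with the (unsigned) divisibility used in the theorem.
≡mod-factors : ∀ m k {a b} → + (m * k) ∣ a - b → (a ≡ b [mod m ]) × (a ≡ b [mod k ])
≡mod-factors m k mk∣a-b =
  congruent (Signed.∣ᵤ⇒∣ (ℕ.∣-trans (ℕ.m∣m*n k) mk∣a-b)) ,
  congruent (Signed.∣ᵤ⇒∣ (ℕ.∣-trans (ℕ.n∣m*n m) mk∣a-b))

≡mod-cancel : ∀ {m a b} u → ℤ.Coprime (+ m) u → a ℤ.* u ≡ b ℤ.* u [mod m ] → a ≡ b [mod m ]
≡mod-cancel {m} {a} {b} u m⊥u (congruent m∣au-bu) = congruent (Signed.∣ᵤ⇒∣
  (ℤ.coprime-divisor (+ m) u (a - b) m⊥u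
    (Signed.∣⇒∣ᵤ (subst (_ Signed.∣_) (sub-factor a b u) m∣au-bu))))

multiple-below⇒0 : ∀ {m d} → m ℕ.∣ d → d ℕ.< m → d ≡ 0
multiple-below⇒0 {d = ℕ.zero}  _   _     = refl
multiple-below⇒0 {d = ℕ.suc _} m∣d d<m = contradiction m∣d (ℕ.>⇒∤ d<m)

≡mod-canonical : ∀ {m a b} → ℤ.0ℤ ℤ.≤ a → a ℤ.< + m → ℤ.0ℤ ℤ.≤ b → b ℤ.< + m →
                 a ≡ b [mod m ] → a ≡ b
≡mod-canonical {m} {+ i} {+ j} _ i<m _ j<m (congruent m∣i-j) = ℤ.i-j≡0⇒i≡j (+ i) (+ j)
  (trans (ℤ.m-n≡m⊖n i j) (ℤ.∣i∣≡0⇒i≡0 (multiple-below⇒0 m∣distance distance<m)))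
  where
  distance<m : ℤ.∣ i ℤ.⊖ j ∣ ℕ.< m
  distance<m = ℕ.≤-<-trans (ℤ.∣m⊝n∣≤m⊔n i j) (ℕ.⊔-pres-<m (ℤ.drop‿+<+ i<m) (ℤ.drop‿+<+ j<m))
  m∣distance : m ℕ.∣ ℤ.∣ i ℤ.⊖ j ∣
  m∣distance = subst (λ t → m ℕ.∣ ℤ.∣ t ∣) (ℤ.m-n≡m⊖n i j) (Signed.∣⇒∣ᵤ m∣i-j)

coprime-* : ∀ {m n k} → Coprime m n → Coprime m k → Coprime m (n * k)
coprime-* m⊥n m⊥k (d∣m , d∣nk) =
  m⊥k (d∣m , ℕ.coprime-divisor (λ (e∣d , e∣n) → m⊥n (ℕ.∣-trans e∣d d∣m , e∣n)) d∣nk)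

coprime-∣ : ∀ {m n d} → Coprime m n → d ℕ.∣ n → Coprime m d
coprime-∣ m⊥n d∣n (e∣m , e∣d) = m⊥n (e∣m , ℕ.∣-trans e∣d d∣n)

-- Reading a representation modulo p and modulo q: all summands but one are
-- multiples of the modulus.
module _ {p q r : ℕ} {n : ℤ} (R : Rep p q r n) where
  open Rep R

  private
    x-residue-identity : ∀ x y z δ P Q T →
      (x ℤ.* Q ℤ.* T ℤ.+ y ℤ.* T ℤ.* P ℤ.+ z ℤ.* P ℤ.* Q ℤ.+ δ ℤ.* P ℤ.* Q ℤ.* T) - x ℤ.* (Q ℤ.* T)
        ≡ (y ℤ.* T ℤ.+ z ℤ.* Q ℤ.+ δ ℤ.* Q ℤ.* T) ℤ.* P
    x-residue-identity = solve-∀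

    y-residue-identity : ∀ x y z δ P Q T →
      (x ℤ.* Q ℤ.* T ℤ.+ y ℤ.* T ℤ.* P ℤ.+ z ℤ.* P ℤ.* Q ℤ.+ δ ℤ.* P ℤ.* Q ℤ.* T) - y ℤ.* (P ℤ.* T)
        ≡ (x ℤ.* T ℤ.+ z ℤ.* P ℤ.+ δ ℤ.* P ℤ.* T) ℤ.* Q
    y-residue-identity = solve-∀

  rep-x-residue : n ≡ x ℤ.* (+ q ℤ.* + r) [mod p ]
  rep-x-residue = congruent (Signed.divides (y ℤ.* + r ℤ.+ z ℤ.* + q ℤ.+ δ ℤ.* + q ℤ.* + r)
    (trans (cong (_- _) eq) (x-residue-identity x y z δ (+ p) (+ q) (+ r))))

  rep-y-residue : n ≡ y ℤ.* (+ p ℤ.* + r) [mod q ]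
  rep-y-residue = congruent (Signed.divides (x ℤ.* + r ℤ.+ z ℤ.* + p ℤ.+ δ ℤ.* + p ℤ.* + r)
    (trans (cong (_- _) eq) (y-residue-identity x y z δ (+ p) (+ q) (+ r))))

digit-unique : ∀ {m n₁ n₂ u v a b} → ℤ.Coprime (+ m) u → u ≡ v [mod m ] →
               n₁ ≡ n₂ [mod m ] → n₁ ≡ a ℤ.* u [mod m ] → n₂ ≡ b ℤ.* v [mod m ] →
               ℤ.0ℤ ℤ.≤ a → a ℤ.< + m → ℤ.0ℤ ℤ.≤ b → b ℤ.< + m → a ≡ b
digit-unique {u = u} {b = b} m⊥u u≡v n₁≡n₂ n₁≡au n₂≡bv 0≤a a<m 0≤b b<m =
  ≡mod-canonical 0≤a a<m 0≤b b<m (≡mod-cancel u m⊥u au≡bu)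
  where
  au≡bu : _ ≡ b ℤ.* u [mod _ ]
  au≡bu = ≡mod-trans (≡mod-sym n₁≡au)
            (≡mod-trans n₁≡n₂ (≡mod-trans n₂≡bv (≡mod-*ˡ b (≡mod-sym u≡v))))

lemma5 : (p q r s : ℕ) → 3 ≤ p → 3 ≤ q → Coprime p q →
    3 ≤ r → Coprime r (p * q) → 3 ≤ s → Coprime s (p * q) →
    (+ (p * q)) ∣ (+ r - + s) →
    (n₁ n₂ : ℤ) → (+ (p * q)) ∣ (n₁ - n₂) →
    (R₁ : Rep p q r n₁) → (R₂ : Rep p q s n₂) →
    f R₁ ≡ f R₂
lemma5 p q r s _ _ p⊥q _ r⊥pq _ _ pq∣r-s n₁ n₂ pq∣n₁-n₂ R₁ R₂ =
  cong₂ ℤ._+_ (cong (ℤ._* + q) x₁≡x₂) (cong (ℤ._* + p) y₁≡y₂)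
  where
  open Rep R₁ renaming (x to x₁; y to y₁; 0≤x to 0≤x₁; x<p to x₁<p; 0≤y to 0≤y₁; y<q to y₁<q)
  open Rep R₂ renaming (x to x₂; y to y₂; 0≤x to 0≤x₂; x<p to x₂<p; 0≤y to 0≤y₂; y<q to y₂<q)

  p⊥r : Coprime p r
  p⊥r = ℕ.sym (coprime-∣ r⊥pq (ℕ.m∣m*n q))
  q⊥r : Coprime q r
  q⊥r = ℕ.sym (coprime-∣ r⊥pq (ℕ.n∣m*n p))
  p⊥qr : ℤ.Coprime (+ p) (+ q ℤ.* + r)
  p⊥qr = subst (Coprime p) (sym (ℤ.abs-* (+ q) (+ r))) (coprime-* p⊥q p⊥r)
  q⊥pr : ℤ.Coprime (+ q) (+ p ℤ.* + r)
  q⊥pr = subst (Coprime q) (sym (ℤ.abs-* (+ p) (+ r))) (coprime-* (ℕ.sym p⊥q) q⊥r)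

  r≡s[p] : + r ≡ + s [mod p ]
  r≡s[p] = proj₁ (≡mod-factors p q pq∣r-s)
  r≡s[q] : + r ≡ + s [mod q ]
  r≡s[q] = proj₂ (≡mod-factors p q pq∣r-s)
  n₁≡n₂[p] : n₁ ≡ n₂ [mod p ]
  n₁≡n₂[p] = proj₁ (≡mod-factors p q pq∣n₁-n₂)
  n₁≡n₂[q] : n₁ ≡ n₂ [mod q ]
  n₁≡n₂[q] = proj₂ (≡mod-factors p q pq∣n₁-n₂)

  x₁≡x₂ : x₁ ≡ x₂
  x₁≡x₂ = digit-unique p⊥qr (≡mod-*ˡ (+ q) r≡s[p]) n₁≡n₂[p]
            (rep-x-residue R₁) (rep-x-residue R₂) 0≤x₁ x₁<p 0≤x₂ x₂<p
  y₁≡y₂ : y₁ ≡ y₂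
  y₁≡y₂ = digit-unique q⊥pr (≡mod-*ˡ (+ p) r≡s[q]) n₁≡n₂[q]
            (rep-y-residue R₁) (rep-y-residue R₂) 0≤y₁ y₁<q 0≤y₂ y₂<q
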